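{- For every $n\geq 1$, the number of shallow $321$-avoiding involutions of length $n$ is $F_{n+1}$, the $(n+1)$-st Fibonacci number.
   Context: For $\pi=\pi_1\cdots\pi_n \in S_n$: $D(\pi)=\sum_{i=1}^n|\pi_i-i|$; $I(\pi)=|\{(i,j): i<j,\ \pi_i>\pi_j\}|$; $T(\pi)=n-\mathrm{cyc}(\pi)$ where $\mathrm{cyc}(\pi)$ is the number of cycles of $\pi$. $\pi$ is shallow if $I(\pi)+T(\pi)=D(\pi)$. $\pi$ avoids $321$ if there are no $i<j<k$ with $\pi_i>\pi_j>\pi_k$. An involution is a permutation with $\pi=\pi^{ -1}$. Fibonacci numbers: $F_1=F_2=1$, $F_m=F_{m-1}+F_{m-2}$. -}

module Defs where

open import Data.Nat using (ℕ; zero; suc; _+_; _∸_; ∣_-_∣)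
open import Data.Nat.Properties using () renaming (_≟_ to _≟ℕ_)
open import Data.Fin using (Fin; toℕ; _<_; _≤_)
open import Data.Fin.Properties using (all?; any?; _<?_; _≤?_; _≟_)
open import Data.Vec using (Vec; []; _∷_; lookup; tabulate)
import Data.Vec as Vec
open import Data.List using (List; []; _∷_; map; concatMap; filter; length; allFin; cartesianProduct)
open import Data.Product using (_×_; _,_; ∃-syntax)
open import Relation.Nullary using (¬_; Dec)
open import Relation.Nullary.Decidable using (¬?; _×-dec_; _→-dec_)
open import Relation.Binary.PropositionalEquality using (_≡_)

-- Convention: a permutation π ∈ S_n is represented by its one-line word
-- π₁ ⋯ πₙ as a vector of length n with entries in Fin n, positions and
-- values shifted to 0,…,n-1 (all statistics below are shift invariant).
Word : ℕ → Set
Word n = Vec (Fin n) n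

IsPerm : ∀ {n} → Word n → Set
IsPerm {n} π = ∀ (i j : Fin n) → lookup π i ≡ lookup π j → i ≡ j

isPerm? : ∀ {n} (π : Word n) → Dec (IsPerm π)
isPerm? π = all? λ i → all? λ j → (lookup π i ≟ lookup π j) →-dec (i ≟ j)

IsInvolution : ∀ {n} → Word n → Set
IsInvolution {n} π = ∀ (i : Fin n) → lookup π (lookup π i) ≡ i

isInvolution? : ∀ {n} (π : Word n) → Dec (IsInvolution π)
isInvolution? π = all? λ i → lookup π (lookup π i) ≟ i

Avoids321 : ∀ {n} → Word n → Set
Avoids321 {n} π = ¬ (∃[ i ] ∃[ j ] ∃[ k ]
  (i < j × j < k × lookup π j < lookup π i × lookup π k < lookup π j))

avoids321? : ∀ {n} (π : Word n) → Dec (Avoids321 π)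
avoids321? π = ¬? (any? λ i → any? λ j → any? λ k →
  (i <? j) ×-dec (j <? k) ×-dec (lookup π j <? lookup π i) ×-dec (lookup π k <? lookup π j))

D : ∀ {n} → Word n → ℕ
D {n} π = Vec.sum (tabulate {n = n} λ i → ∣ toℕ (lookup π i) - toℕ i ∣)

I : ∀ {n} → Word n → ℕ
I {n} π = length (filter (λ { (i , j) → (i <? j) ×-dec (lookup π j <? lookup π i) })
                         (cartesianProduct (allFin n) (allFin n)))

iter : ∀ {n} → Word n → ℕ → Fin n → Fin n
iter π zero    i = i
iter π (suc k) i = lookup π (iter π k i)

-- i is the least element of its cycle {π^k(i) : k ∈ ℕ}; since a cycle of
-- a permutation of Fin n has length ≤ n it suffices to take k < n.
IsCycleMin : ∀ {n} → Word n → Fin n → Set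
IsCycleMin {n} π i = ∀ (k : Fin n) → i ≤ iter π (toℕ k) i

isCycleMin? : ∀ {n} (π : Word n) (i : Fin n) → Dec (IsCycleMin π i)
isCycleMin? π i = all? λ k → i ≤? iter π (toℕ k) i

-- cyc(π) = number of cycles = number of cycle minima
cyc : ∀ {n} → Word n → ℕ
cyc {n} π = length (filter (isCycleMin? π) (allFin n))

T : ∀ {n} → Word n → ℕ
T {n} π = n ∸ cyc π

Shallow : ∀ {n} → Word n → Set
Shallow π = I π + T π ≡ D π

shallow? : ∀ {n} (π : Word n) → Dec (Shallow π)
shallow? π = (I π + T π) ≟ℕ D π

words : (n k : ℕ) → List (Vec (Fin n) k)
words n zero    = [] ∷ []
words n (suc k) = concatMap (λ a → map (a ∷_) (words n k)) (allFin n)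

numShallow321Inv : ℕ → ℕ
numShallow321Inv n = length (filter
  (λ π → isPerm? π ×-dec isInvolution? π ×-dec avoids321? π ×-dec shallow? π)
  (words n n))

F : ℕ → ℕ
F zero          = 0
F (suc zero)    = 1
F (suc (suc m)) = F (suc m) + F m

{-# OPTIONS --safe #-}
module Submission where

-- Fix a position i of a permutation π and let L, A, B count the j < i with
-- π j < π i, the j < i with π j > π i, and the j > i with π j < π i.  Then
-- L + A = i and L + B = π i, and if π avoids 321 one of A, B vanishes, so
-- B = (π i − i)⁺.  Summing over i, I(π) is the sum of the excedances
-- (π i − i)⁺, which for a permutation equals the sum of the deficiencies
-- (i − π i)⁺, i.e. D(π)/2.  For an involution the cycle minima are the i
-- with i ≤ π i, so T(π) = #{i : π i < i}, and shallowness becomes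
-- Σ [π i < i] = Σ (i − π i)⁺: no entry lies more than one below its
-- position.  Such involutions are the products of disjoint adjacent
-- transpositions; they avoid 321, and splitting off the first block (a fixed
-- point, or the first two letters swapped) gives the Fibonacci recursion.

open import Data.Bool.Base using (if_then_else_)
open import Data.Empty using (⊥; ⊥-elim)
open import Data.Fin as Fin using (Fin; zero; suc; toℕ)
open import Data.Fin.Permutation using (permutation)
import Data.Fin.Properties as Finₚ
open import Data.List
  using (List; []; _∷_; _++_; allFin; map; filter; length; tabulate; concatMap;
         cartesianProduct; cartesianProductWith)
import Data.List.Properties as Listₚ
open import Data.List.Membership.Propositional using (_∈_)
open import Data.List.Membership.Propositional.Properties
  using (∈-map⁺; ∈-map⁻; ∈-++⁺ˡ; ∈-++⁺ʳ; ∈-++⁻; ∈-filter⁺; ∈-filter⁻; ∈-allFin;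
         ∈-cartesianProductWith⁺)
open import Data.List.Membership.Propositional.Properties.WithK using (unique∧set⇒bag)
open import Data.List.Relation.Binary.BagAndSetEquality using (∼bag⇒↭)
open import Data.List.Relation.Binary.Permutation.Propositional.Properties using (↭-length)
open import Data.List.Relation.Unary.All using ([])
open import Data.List.Relation.Unary.AllPairs using ([]; _∷_)
open import Data.List.Relation.Unary.Any using (here)
open import Data.List.Relation.Unary.Unique.Propositional using (Unique)
import Data.List.Relation.Unary.Unique.Propositional.Properties as Uniqueₚ
open import Data.Nat using (ℕ; zero; suc; _+_; _∸_; _≤_; _<_; ∣_-_∣; z≤n; s≤s)
open import Data.Nat.Properties
open import Algebra.Properties.CommutativeMonoid.Sum +-0-commutativeMonoid
  using (sum; sum-syntax; sum-cong-≗; sum-replicate-zero; ∑-distrib-+; sum-permute)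
open import Data.Product using (_×_; _,_; proj₁; proj₂; ∃-syntax; swap)
open import Data.Sum using (_⊎_; inj₁; inj₂; [_,_]′)
open import Data.Vec as Vec using (Vec; []; _∷_; lookup)
import Data.Vec.Properties as Vecₚ
open import Function using (id; _∘_; _⇔_; mk⇔; Equivalence)
open import Relation.Binary using (tri<; tri≈; tri>)
open import Relation.Binary.PropositionalEquality
  using (_≡_; _≢_; refl; sym; trans; cong; cong₂; subst; module ≡-Reasoning)
open import Relation.Nullary using (¬_; Dec; yes; no; does)
open import Relation.Nullary.Decidable using (_×-dec_; does-⇔)
open import Relation.Unary using (Pred; Decidable)

open import Level using (Level)

open import Defs

open Equivalence using (to; from)

private
  variable
    ℓ : Level
    A B C : Set ℓ
    P Q R : Set ℓ
    m n k : ℕ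

𝟙 : Dec P → ℕ
𝟙 P? = if does P? then 1 else 0

𝟙≤1 : (P? : Dec P) → 𝟙 P? ≤ 1
𝟙≤1 (yes _) = s≤s z≤n
𝟙≤1 (no _)  = z≤n

𝟙-cong : P ⇔ Q → (P? : Dec P) (Q? : Dec Q) → 𝟙 P? ≡ 𝟙 Q?
𝟙-cong P⇔Q P? Q? = cong (λ t → if t then 1 else 0) (does-⇔ P⇔Q P? Q?)

𝟙+𝟙≡1 : (P? : Dec P) (Q? : Dec Q) → P ⊎ Q → (P → ¬ Q) → 𝟙 P? + 𝟙 Q? ≡ 1
𝟙+𝟙≡1 (yes x) (yes y) _       excl = ⊥-elim (excl x y)
𝟙+𝟙≡1 (yes _) (no _)  _       _    = refl
𝟙+𝟙≡1 (no _)  (yes _) _       _    = refl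
𝟙+𝟙≡1 (no ¬x) (no _)  (inj₁ x) _    = ⊥-elim (¬x x)
𝟙+𝟙≡1 (no _)  (no ¬y) (inj₂ y) _    = ⊥-elim (¬y y)

𝟙-×-partition : (P? : Dec P) (Q? : Dec Q) (R? : Dec R) → (P → Q ⊎ R) → (Q → ¬ R) →
                𝟙 (P? ×-dec Q?) + 𝟙 (P? ×-dec R?) ≡ 𝟙 P?
𝟙-×-partition (yes x) Q? R? cover excl = 𝟙+𝟙≡1 Q? R? (cover x) excl
𝟙-×-partition (no _)  Q? R? cover excl = refl

𝟙-×-comm : (P? : Dec P) (Q? : Dec Q) → 𝟙 (P? ×-dec Q?) ≡ 𝟙 (Q? ×-dec P?)
𝟙-×-comm P? Q? = 𝟙-cong (mk⇔ swap swap) (P? ×-dec Q?) (Q? ×-dec P?)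

∑-mono-≤ : {f g : Fin n → ℕ} → (∀ i → f i ≤ g i) → sum f ≤ sum g
∑-mono-≤ {zero}  f≤g = z≤n
∑-mono-≤ {suc n} f≤g = +-mono-≤ (f≤g zero) (∑-mono-≤ (f≤g ∘ suc))

∑-≡⇒≗ : {f g : Fin n → ℕ} → (∀ i → f i ≤ g i) → sum f ≡ sum g → ∀ i → f i ≡ g i
∑-≡⇒≗ {suc n} {f} {g} f≤g ∑≡ zero with m≤n⇒m<n∨m≡n (f≤g zero)
... | inj₂ f₀≡g₀ = f₀≡g₀
... | inj₁ f₀<g₀ = ⊥-elim (<⇒≢ (+-mono-<-≤ f₀<g₀ (∑-mono-≤ (f≤g ∘ suc))) ∑≡)
∑-≡⇒≗ {suc n} {f} {g} f≤g ∑≡ (suc i) = ∑-≡⇒≗ (f≤g ∘ suc) tail-∑≡ i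
  where
  tail-∑≡ : sum (f ∘ suc) ≡ sum (g ∘ suc)
  tail-∑≡ = +-cancelˡ-≡ (f zero) _ _
              (trans ∑≡ (cong (_+ sum (g ∘ suc)) (sym (∑-≡⇒≗ f≤g ∑≡ zero))))

∑-const-1 : ∀ n → ∑[ i < n ] 1 ≡ n
∑-const-1 zero    = refl
∑-const-1 (suc n) = cong suc (∑-const-1 n)

Vec-sum-tabulate : (f : Fin n → ℕ) → Vec.sum (Vec.tabulate f) ≡ sum f
Vec-sum-tabulate {zero}  f = refl
Vec-sum-tabulate {suc n} f = cong (f zero +_) (Vec-sum-tabulate (f ∘ suc))

count : {P : Pred (Fin n) ℓ} → Decidable P → ℕ
count {n = n} P? = ∑[ i < n ] 𝟙 (P? i)

0<count⇒∃ : {P : Pred (Fin n) ℓ} (P? : Decidable P) → 0 < count P? → ∃[ i ] P i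
0<count⇒∃ {suc n} P? 0<c with P? zero
... | yes P₀ = zero , P₀
... | no _   = let i , Pi = 0<count⇒∃ (P? ∘ suc) 0<c in suc i , Pi

count-< : (i : Fin n) → count {n = n} (Finₚ._<? i) ≡ toℕ i
count-< {suc n} zero    = sum-replicate-zero n
count-< {suc n} (suc i) = cong suc (count-< i)

count+count≡n : {P Q : Pred (Fin n) ℓ} (P? : Decidable P) (Q? : Decidable Q) →
                (∀ i → P i ⊎ Q i) → (∀ i → P i → ¬ Q i) → count P? + count Q? ≡ n
count+count≡n {n} P? Q? cover excl = begin
  count P? + count Q?              ≡⟨ ∑-distrib-+ (𝟙 ∘ P?) (𝟙 ∘ Q?) ⟨
  ∑[ i < n ] (𝟙 (P? i) + 𝟙 (Q? i)) ≡⟨ sum-cong-≗ (λ i → 𝟙+𝟙≡1 (P? i) (Q? i) (cover i) (excl i)) ⟩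
  ∑[ i < n ] 1                     ≡⟨ ∑-const-1 n ⟩
  n                                ∎
  where open ≡-Reasoning

count-×-partition : {P Q R : Pred (Fin n) ℓ}
                    (P? : Decidable P) (Q? : Decidable Q) (R? : Decidable R) →
                    (∀ i → P i → Q i ⊎ R i) → (∀ i → Q i → ¬ R i) →
                    count (λ i → P? i ×-dec Q? i) + count (λ i → P? i ×-dec R? i) ≡ count P?
count-×-partition P? Q? R? cover excl =
  trans (sym (∑-distrib-+ (λ i → 𝟙 (P? i ×-dec Q? i)) (λ i → 𝟙 (P? i ×-dec R? i))))
        (sum-cong-≗ (λ i → 𝟙-×-partition (P? i) (Q? i) (R? i) (cover i) (excl i)))

count-×-comm : {P Q : Pred (Fin n) ℓ} (P? : Decidable P) (Q? : Decidable Q) →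
               count (λ i → P? i ×-dec Q? i) ≡ count (λ i → Q? i ×-dec P? i)
count-×-comm P? Q? = sum-cong-≗ (λ i → 𝟙-×-comm (P? i) (Q? i))

length-filter-tabulate : {P : Pred A ℓ} (P? : Decidable P) (f : Fin n → A) →
                         length (filter P? (tabulate f)) ≡ count (P? ∘ f)
length-filter-tabulate {n = zero}  P? f = refl
length-filter-tabulate {n = suc n} P? f with P? (f zero)
... | yes _ = cong suc (length-filter-tabulate P? (f ∘ suc))
... | no _  = length-filter-tabulate P? (f ∘ suc)

length-filter-cartesianProduct :
  {P : Pred (A × B) ℓ} (P? : Decidable P) (f : Fin m → A) (g : Fin n → B) →
  length (filter P? (cartesianProduct (tabulate f) (tabulate g))) ≡ ∑[ i < m ] count (λ j → P? (f i , g j))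
length-filter-cartesianProduct {m = zero}  P? f g = refl
length-filter-cartesianProduct {A = A} {B = B} {m = suc m} P? f g = begin
  length (filter P? (row ++ rows))                   ≡⟨ cong length (Listₚ.filter-++ P? row rows) ⟩
  length (filter P? row ++ filter P? rows)           ≡⟨ Listₚ.length-++ (filter P? row) ⟩
  length (filter P? row) + length (filter P? rows)
    ≡⟨ cong₂ _+_ (trans (cong (length ∘ filter P?) (Listₚ.map-tabulate g (f zero ,_)))
                        (length-filter-tabulate P? (λ j → f zero , g j)))
                 (length-filter-cartesianProduct P? (f ∘ suc) g) ⟩
  count (λ j → P? (f zero , g j)) + ∑[ i < m ] count (λ j → P? (f (suc i) , g j)) ∎
  where
  open ≡-Reasoning
  row rows : List (A × B)
  row  = map (f zero ,_) (tabulate g)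
  rows = cartesianProduct (tabulate (f ∘ suc)) (tabulate g)

unique∧set⇒length≡ : {xs ys : List A} → Unique xs → Unique ys →
                     (∀ {z} → z ∈ xs ⇔ z ∈ ys) → length xs ≡ length ys
unique∧set⇒length≡ xs! ys! xs≈ys = ↭-length (∼bag⇒↭ (unique∧set⇒bag xs! ys! xs≈ys))

concatMap-map≡cartesianProductWith : (f : A → B → C) (xs : List A) (ys : List B) →
  concatMap (λ x → map (f x) ys) xs ≡ cartesianProductWith f xs ys
concatMap-map≡cartesianProductWith f []       ys = refl
concatMap-map≡cartesianProductWith f (x ∷ xs) ys =
  cong (map (f x) ys ++_) (concatMap-map≡cartesianProductWith f xs ys)

words-unique : ∀ n k → Unique (words n k)
words-unique n zero    = [] ∷ []
words-unique n (suc k) =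
  subst Unique (sym (concatMap-map≡cartesianProductWith _∷_ (allFin n) (words n k)))
        (Uniqueₚ.cartesianProductWith⁺ _∷_ Vecₚ.∷-injective (Uniqueₚ.allFin⁺ n) (words-unique n k))

∈-words : (v : Vec (Fin n) k) → v ∈ words n k
∈-words []      = here refl
∈-words {n} {suc k} (x ∷ v) =
  subst (x ∷ v ∈_) (sym (concatMap-map≡cartesianProductWith _∷_ (allFin n) (words n k)))
        (∈-cartesianProductWith⁺ _∷_ (∈-allFin x) (∈-words v))

length-filter-words : {P : Pred (Vec (Fin n) k) ℓ} (P? : Decidable P) {xs : List (Vec (Fin n) k)} →
                      Unique xs → (∀ {v} → P v ⇔ v ∈ xs) → length (filter P? (words n k)) ≡ length xs
length-filter-words {n} {k} P? xs! P⇔∈xs = unique∧set⇒length≡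
  (Uniqueₚ.filter⁺ P? {xs = words n k} (words-unique n k)) xs!
  (mk⇔ (λ v∈ → to P⇔∈xs (proj₂ (∈-filter⁻ P? {xs = words n k} v∈)))
       (λ v∈xs → ∈-filter⁺ P? {xs = words n k} (∈-words _) (from P⇔∈xs v∈xs)))

≢⇒<⊎> : {i j : Fin n} → i ≢ j → toℕ i < toℕ j ⊎ toℕ j < toℕ i
≢⇒<⊎> {i = i} {j} i≢j with Finₚ.<-cmp i j
... | tri< i<j _ _ = inj₁ i<j
... | tri≈ _ i≡j _ = ⊥-elim (i≢j i≡j)
... | tri> _ _ j<i = inj₂ j<i

∣m-n∣≡[m∸n]+[n∸m] : ∀ m n → ∣ m - n ∣ ≡ (m ∸ n) + (n ∸ m)
∣m-n∣≡[m∸n]+[n∸m] m n with ≤-total m n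
... | inj₁ m≤n rewrite m≤n⇒m∸n≡0 m≤n = m≤n⇒∣m-n∣≡n∸m m≤n
... | inj₂ n≤m rewrite m≤n⇒m∸n≡0 n≤m = trans (m≤n⇒∣n-m∣≡n∸m n≤m) (sym (+-identityʳ _))

m+[n∸m]≡n+[m∸n] : ∀ m n → m + (n ∸ m) ≡ n + (m ∸ n)
m+[n∸m]≡n+[m∸n] m n with ≤-total m n
... | inj₁ m≤n rewrite m≤n⇒m∸n≡0 m≤n | +-identityʳ n = m+[n∸m]≡n m≤n
... | inj₂ n≤m rewrite m≤n⇒m∸n≡0 n≤m | +-identityʳ m = sym (m+[n∸m]≡n n≤m)

[l+b]∸[l+a]≡b : ∀ l a b → (0 < a → 0 < b → ⊥) → (l + b) ∸ (l + a) ≡ b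
[l+b]∸[l+a]≡b l zero    b       _     = trans (cong (l + b ∸_) (+-identityʳ l)) (m+n∸m≡n l b)
[l+b]∸[l+a]≡b l (suc a) zero    _     = m≤n⇒m∸n≡0 (+-monoʳ-≤ l z≤n)
[l+b]∸[l+a]≡b l (suc a) (suc b) ¬both = ⊥-elim (¬both (s≤s z≤n) (s≤s z≤n))

𝟙[n<m]≤m∸n : ∀ {m n} (n<m? : Dec (n < m)) → 𝟙 n<m? ≤ m ∸ n
𝟙[n<m]≤m∸n (yes n<m) = m<n⇒0<n∸m n<m
𝟙[n<m]≤m∸n (no _)    = z≤n

m∸n≤1⇒𝟙[n<m]≡m∸n : ∀ {m n} (n<m? : Dec (n < m)) → m ∸ n ≤ 1 → 𝟙 n<m? ≡ m ∸ n
m∸n≤1⇒𝟙[n<m]≡m∸n (yes n<m) m∸n≤1 = ≤-antisym (m<n⇒0<n∸m n<m) m∸n≤1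
m∸n≤1⇒𝟙[n<m]≡m∸n (no n≮m)  _     = sym (m≤n⇒m∸n≡0 (≮⇒≥ n≮m))

excedance deficiency : Word n → Fin n → ℕ
excedance π i  = toℕ (lookup π i) ∸ toℕ i
deficiency π i = toℕ i ∸ toℕ (lookup π i)

smallerAfter smallerBefore largerBefore : Word n → Fin n → ℕ
smallerAfter  π i = count λ j → (i Finₚ.<? j) ×-dec (lookup π j Finₚ.<? lookup π i)
smallerBefore π i = count λ j → (j Finₚ.<? i) ×-dec (lookup π j Finₚ.<? lookup π i)
largerBefore  π i = count λ j → (j Finₚ.<? i) ×-dec (lookup π i Finₚ.<? lookup π j)

D≡∑excedance+∑deficiency : (π : Word n) → D π ≡ ∑[ i < n ] excedance π i + ∑[ i < n ] deficiency π i
D≡∑excedance+∑deficiency π = trans (Vec-sum-tabulate (λ i → ∣ toℕ (lookup π i) - toℕ i ∣))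
  (trans (sum-cong-≗ (λ i → ∣m-n∣≡[m∸n]+[n∸m] (toℕ (lookup π i)) (toℕ i)))
         (∑-distrib-+ (excedance π) (deficiency π)))

I≡∑smallerAfter : (π : Word n) → I π ≡ ∑[ i < n ] smallerAfter π i
I≡∑smallerAfter {n} π = length-filter-cartesianProduct {m = n} {n = n} _ id id

isCycleMin⇒≤ : (π : Word n) (i : Fin n) → IsCycleMin π i → toℕ i ≤ toℕ (lookup π i)
isCycleMin⇒≤                 π zero    _   = z≤n
isCycleMin⇒≤ {suc (suc n)} π (suc i) min = min (suc zero)

module Invertible {n} (π : Word n) (π⁻¹ : Fin n → Fin n)
                  (π∘π⁻¹ : ∀ i → lookup π (π⁻¹ i) ≡ i)
                  (π⁻¹∘π : ∀ i → π⁻¹ (lookup π i) ≡ i) where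

  ∑-reindex : (f : Fin n → ℕ) → ∑[ i < n ] f i ≡ ∑[ i < n ] f (lookup π i)
  ∑-reindex f = sum-permute f (permutation (lookup π) π⁻¹ π∘π⁻¹ π⁻¹∘π)

  lookup-injective : ∀ {i j} → lookup π i ≡ lookup π j → i ≡ j
  lookup-injective {i} {j} πi≡πj = trans (sym (π⁻¹∘π i)) (trans (cong π⁻¹ πi≡πj) (π⁻¹∘π j))

  ∑excedance≡∑deficiency : ∑[ i < n ] excedance π i ≡ ∑[ i < n ] deficiency π i
  ∑excedance≡∑deficiency = +-cancelˡ-≡ (∑[ i < n ] toℕ i) _ _ (begin
    ∑[ i < n ] toℕ i + ∑[ i < n ] excedance π i
      ≡⟨ ∑-distrib-+ toℕ (excedance π) ⟨
    ∑[ i < n ] (toℕ i + excedance π i)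
      ≡⟨ sum-cong-≗ (λ i → m+[n∸m]≡n+[m∸n] (toℕ i) (toℕ (lookup π i))) ⟩
    ∑[ i < n ] (toℕ (lookup π i) + deficiency π i)
      ≡⟨ ∑-distrib-+ (toℕ ∘ lookup π) (deficiency π) ⟩
    ∑[ i < n ] toℕ (lookup π i) + ∑[ i < n ] deficiency π i
      ≡⟨ cong (_+ ∑[ i < n ] deficiency π i) (∑-reindex toℕ) ⟨
    ∑[ i < n ] toℕ i + ∑[ i < n ] deficiency π i ∎)
    where open ≡-Reasoning

  smallerBefore+largerBefore≡toℕ : ∀ i → smallerBefore π i + largerBefore π i ≡ toℕ i
  smallerBefore+largerBefore≡toℕ i = trans
    (count-×-partition (λ j → j Finₚ.<? i)
                       (λ j → lookup π j Finₚ.<? lookup π i) (λ j → lookup π i Finₚ.<? lookup π j)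
                       (λ j j<i → ≢⇒<⊎> (Finₚ.<⇒≢ j<i ∘ lookup-injective)) (λ j → <-asym))
    (count-< i)

  smallerBefore+smallerAfter≡toℕ∘π : ∀ i → smallerBefore π i + smallerAfter π i ≡ toℕ (lookup π i)
  smallerBefore+smallerAfter≡toℕ∘π i = begin
    smallerBefore π i + smallerAfter π i
      ≡⟨ cong₂ _+_ (count-×-comm (λ j → j Finₚ.<? i) πj<πi?)
                   (count-×-comm (λ j → i Finₚ.<? j) πj<πi?) ⟩
    count (λ j → πj<πi? j ×-dec j Finₚ.<? i) + count (λ j → πj<πi? j ×-dec i Finₚ.<? j)
      ≡⟨ count-×-partition πj<πi? (λ j → j Finₚ.<? i) (λ j → i Finₚ.<? j)
           (λ j πj<πi → ≢⇒<⊎> (λ j≡i → <-irrefl (cong (toℕ ∘ lookup π) j≡i) πj<πi))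
           (λ j → <-asym) ⟩
    count πj<πi?
      ≡⟨ ∑-reindex (λ k → 𝟙 (k Finₚ.<? lookup π i)) ⟨
    count {n = n} (Finₚ._<? lookup π i)
      ≡⟨ count-< (lookup π i) ⟩
    toℕ (lookup π i) ∎
    where
    open ≡-Reasoning
    πj<πi? : Decidable (λ j → toℕ (lookup π j) < toℕ (lookup π i))
    πj<πi? j = lookup π j Finₚ.<? lookup π i

  module _ (avoids : Avoids321 π) where

    ¬largerBefore∧smallerAfter : ∀ i → 0 < largerBefore π i → 0 < smallerAfter π i → ⊥
    ¬largerBefore∧smallerAfter i 0<before 0<after =
      let j , j<i , πi<πj = 0<count⇒∃ (λ j → (j Finₚ.<? i) ×-dec (lookup π i Finₚ.<? lookup π j))
                                      0<before
          k , i<k , πk<πi = 0<count⇒∃ (λ k → (i Finₚ.<? k) ×-dec (lookup π k Finₚ.<? lookup π i))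
                                      0<after
      in avoids (j , i , k , j<i , i<k , πi<πj , πk<πi)

    smallerAfter≡excedance : ∀ i → smallerAfter π i ≡ excedance π i
    smallerAfter≡excedance i = begin
      smallerAfter π i
        ≡⟨ [l+b]∸[l+a]≡b (smallerBefore π i) _ _ (¬largerBefore∧smallerAfter i) ⟨
      (smallerBefore π i + smallerAfter π i) ∸ (smallerBefore π i + largerBefore π i)
        ≡⟨ cong₂ _∸_ (smallerBefore+smallerAfter≡toℕ∘π i) (smallerBefore+largerBefore≡toℕ i) ⟩
      excedance π i ∎
      where open ≡-Reasoning

    I≡∑excedance : I π ≡ ∑[ i < n ] excedance π i
    I≡∑excedance = trans (I≡∑smallerAfter π) (sum-cong-≗ smallerAfter≡excedance)

iter-involution : {π : Word n} → IsInvolution π → ∀ k i → iter π k i ≡ i ⊎ iter π k i ≡ lookup π i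
iter-involution inv zero    i = inj₁ refl
iter-involution {π = π} inv (suc k) i with iter-involution inv k i
... | inj₁ πᵏi≡i  = inj₂ (cong (lookup π) πᵏi≡i)
... | inj₂ πᵏi≡πi = inj₁ (trans (cong (lookup π) πᵏi≡πi) (inv i))

≤⇒isCycleMin : {π : Word n} → IsInvolution π → ∀ i → toℕ i ≤ toℕ (lookup π i) → IsCycleMin π i
≤⇒isCycleMin {π = π} inv i i≤πi k with iter-involution inv (toℕ k) i
... | inj₁ πᵏi≡i  = subst (λ x → toℕ i ≤ toℕ x) (sym πᵏi≡i) ≤-refl
... | inj₂ πᵏi≡πi = subst (λ x → toℕ i ≤ toℕ x) (sym πᵏi≡πi) i≤πi

cyc≡count[i≤πi] : {π : Word n} → IsInvolution π → cyc π ≡ count (λ i → i Finₚ.≤? lookup π i)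
cyc≡count[i≤πi] {π = π} inv = trans (length-filter-tabulate (isCycleMin? π) id)
  (sum-cong-≗ λ i → 𝟙-cong (mk⇔ (isCycleMin⇒≤ π i) (≤⇒isCycleMin inv i))
                           (isCycleMin? π i) (i Finₚ.≤? lookup π i))

T≡count[πi<i] : {π : Word n} → IsInvolution π → T π ≡ count (λ i → lookup π i Finₚ.<? i)
T≡count[πi<i] {n} {π} inv = begin
  n ∸ cyc π                                    ≡⟨ cong₂ _∸_ (sym weak+deficient) (cyc≡count[i≤πi] inv) ⟩
  count weak? + count deficient? ∸ count weak? ≡⟨ m+n∸m≡n (count weak?) (count deficient?) ⟩
  count deficient?                             ∎
  where
  open ≡-Reasoning
  weak? : Decidable (λ i → toℕ i ≤ toℕ (lookup π i))
  weak? i = i Finₚ.≤? lookup π i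
  deficient? : Decidable (λ i → toℕ (lookup π i) < toℕ i)
  deficient? i = lookup π i Finₚ.<? i
  weak+deficient : count weak? + count deficient? ≡ n
  weak+deficient = count+count≡n weak? deficient?
                     (λ i → ≤-<-connex (toℕ i) (toℕ (lookup π i))) (λ i → ≤⇒≯)

shallow⇔deficiency≤1 : {π : Word n} → IsInvolution π → Avoids321 π →
                       Shallow π ⇔ (∀ i → deficiency π i ≤ 1)
shallow⇔deficiency≤1 {n} {π} inv avoids = mk⇔
  (λ sh i → subst (_≤ 1) (∑-≡⇒≗ (λ i → 𝟙[n<m]≤m∸n (deficient? i)) (deficient≡depth sh) i)
                  (𝟙≤1 (deficient? i)))
  (λ drop≤1 → shallow (sum-cong-≗ λ i → m∸n≤1⇒𝟙[n<m]≡m∸n (deficient? i) (drop≤1 i)))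
  where
  open Invertible π (lookup π) inv inv
  deficient? : Decidable (λ i → toℕ (lookup π i) < toℕ i)
  deficient? i = lookup π i Finₚ.<? i
  depth : ℕ
  depth = ∑[ i < n ] deficiency π i
  I+T≡ : I π + T π ≡ depth + count deficient?
  I+T≡ = cong₂ _+_ (trans (I≡∑excedance avoids) ∑excedance≡∑deficiency) (T≡count[πi<i] inv)
  D≡ : D π ≡ depth + depth
  D≡ = trans (D≡∑excedance+∑deficiency π) (cong (_+ depth) ∑excedance≡∑deficiency)
  deficient≡depth : Shallow π → count deficient? ≡ depth
  deficient≡depth sh = +-cancelˡ-≡ depth _ _ (trans (sym I+T≡) (trans sh D≡))
  shallow : count deficient? ≡ depth → Shallow π
  shallow deficient≡depth = trans I+T≡ (trans (cong (depth +_) deficient≡depth) (sym D≡))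

-- For an involution, π i ≥ i − 1 for all i forces |π i − i| ≤ 1, i.e. π is a
-- product of disjoint adjacent transpositions.
IsAdjacentInvolution : Word n → Set
IsAdjacentInvolution π = IsInvolution π × (∀ i → deficiency π i ≤ 1)

involution⇒perm : (π : Word n) → IsInvolution π → IsPerm π
involution⇒perm π inv i j πi≡πj = trans (sym (inv i)) (trans (cong (lookup π) πi≡πj) (inv j))

m∸n≤o⇒m≤o+n : ∀ m n {o} → m ∸ n ≤ o → m ≤ o + n
m∸n≤o⇒m≤o+n m n {o} m∸n≤o =
  ≤-trans (m≤n+m∸n m n) (≤-trans (+-monoʳ-≤ n m∸n≤o) (≤-reflexive (+-comm n o)))

adjacentInvolution⇒avoids321 : (π : Word n) → IsAdjacentInvolution π → Avoids321 π
adjacentInvolution⇒avoids321 π (inv , drop≤1) (i , j , k , i<j , j<k , πj<πi , πk<πj) =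
  <-irrefl refl (begin-strict
    suc (toℕ i)            <⟨ ≤-trans (s≤s i<j) j<k ⟩
    toℕ k                  ≤⟨ m∸n≤o⇒m≤o+n _ _ (drop≤1 k) ⟩
    suc (toℕ (lookup π k)) <⟨ ≤-trans (s≤s πk<πj) πj<πi ⟩
    toℕ (lookup π i)       ≤⟨ πi≤1+i ⟩
    suc (toℕ i)            ∎)
  where
  open ≤-Reasoning
  πi≤1+i : toℕ (lookup π i) ≤ suc (toℕ i)
  πi≤1+i = m∸n≤o⇒m≤o+n _ _
             (subst (λ x → toℕ (lookup π i) ∸ toℕ x ≤ 1) (inv i) (drop≤1 (lookup π i)))

fix∷ : Word n → Word (suc n)
fix∷ w = zero ∷ Vec.map suc w

swap∷ : Word n → Word (suc (suc n))
swap∷ w = suc zero ∷ zero ∷ Vec.map (Fin.suc ∘ Fin.suc) w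

adjacentInvolutions : (n : ℕ) → List (Word n)
adjacentInvolutions zero          = [] ∷ []
adjacentInvolutions (suc zero)    = fix∷ [] ∷ []
adjacentInvolutions (suc (suc n)) =
  map fix∷ (adjacentInvolutions (suc n)) ++ map swap∷ (adjacentInvolutions n)

length-adjacentInvolutions : ∀ n → length (adjacentInvolutions n) ≡ F (suc n)
length-adjacentInvolutions zero          = refl
length-adjacentInvolutions (suc zero)    = refl
length-adjacentInvolutions (suc (suc n)) = begin
  length (map fix∷ (adjacentInvolutions (suc n)) ++ map swap∷ (adjacentInvolutions n))
    ≡⟨ Listₚ.length-++ (map fix∷ (adjacentInvolutions (suc n))) ⟩
  length (map fix∷ (adjacentInvolutions (suc n))) + length (map swap∷ (adjacentInvolutions n))
    ≡⟨ cong₂ _+_ (Listₚ.length-map fix∷ (adjacentInvolutions (suc n)))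
                 (Listₚ.length-map swap∷ (adjacentInvolutions n)) ⟩
  length (adjacentInvolutions (suc n)) + length (adjacentInvolutions n)
    ≡⟨ cong₂ _+_ (length-adjacentInvolutions (suc n)) (length-adjacentInvolutions n) ⟩
  F (suc (suc n)) + F (suc n) ∎
  where open ≡-Reasoning

map-injective : {f : A → B} → (∀ {x y} → f x ≡ f y → x ≡ y) →
                {xs ys : Vec A k} → Vec.map f xs ≡ Vec.map f ys → xs ≡ ys
map-injective f-inj {[]}     {[]}     _  = refl
map-injective f-inj {x ∷ xs} {y ∷ ys} eq =
  let fx≡fy , fxs≡fys = Vecₚ.∷-injective eq in cong₂ _∷_ (f-inj fx≡fy) (map-injective f-inj fxs≡fys)

fix∷-injective : {w w′ : Word n} → fix∷ w ≡ fix∷ w′ → w ≡ w′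
fix∷-injective = map-injective Finₚ.suc-injective ∘ Vecₚ.∷-injectiveʳ

swap∷-injective : {w w′ : Word n} → swap∷ w ≡ swap∷ w′ → w ≡ w′
swap∷-injective =
  map-injective (Finₚ.suc-injective ∘ Finₚ.suc-injective) ∘ Vecₚ.∷-injectiveʳ ∘ Vecₚ.∷-injectiveʳ

adjacentInvolutions-unique : ∀ n → Unique (adjacentInvolutions n)
adjacentInvolutions-unique zero          = [] ∷ []
adjacentInvolutions-unique (suc zero)    = [] ∷ []
adjacentInvolutions-unique (suc (suc n)) = Uniqueₚ.++⁺
  (Uniqueₚ.map⁺ fix∷-injective (adjacentInvolutions-unique (suc n)))
  (Uniqueₚ.map⁺ swap∷-injective (adjacentInvolutions-unique n))
  disjoint
  where
  disjoint : ∀ {π} → ¬ (π ∈ map fix∷ (adjacentInvolutions (suc n)) ×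
                        π ∈ map swap∷ (adjacentInvolutions n))
  disjoint (π∈fix , π∈swap) with ∈-map⁻ fix∷ π∈fix | ∈-map⁻ swap∷ π∈swap
  ... | _ , _ , refl | _ , _ , ()

fix∷-adjacent⇔ : {w : Word n} → IsAdjacentInvolution w ⇔ IsAdjacentInvolution (fix∷ w)
fix∷-adjacent⇔ {w = w} = mk⇔
  (λ (inv , drop≤1) → (λ { zero → refl ; (suc i) → trans (lookup² i) (cong suc (inv i)) })
                    , (λ { zero → z≤n ; (suc i) → subst (_≤ 1) (sym (deficiency≡ i)) (drop≤1 i) }))
  (λ (inv , drop≤1) → (λ i → Finₚ.suc-injective (trans (sym (lookup² i)) (inv (suc i))))
                    , (λ i → subst (_≤ 1) (deficiency≡ i) (drop≤1 (suc i))))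
  where
  lookup² : ∀ i → lookup (fix∷ w) (lookup (fix∷ w) (suc i)) ≡ suc (lookup w (lookup w i))
  lookup² i = trans (cong (lookup (fix∷ w)) (Vecₚ.lookup-map i suc w))
                    (Vecₚ.lookup-map (lookup w i) suc w)
  deficiency≡ : ∀ i → deficiency (fix∷ w) (suc i) ≡ deficiency w i
  deficiency≡ i = cong (λ x → toℕ (suc i) ∸ toℕ x) (Vecₚ.lookup-map i suc w)

swap∷-adjacent⇔ : {w : Word n} → IsAdjacentInvolution w ⇔ IsAdjacentInvolution (swap∷ w)
swap∷-adjacent⇔ {w = w} = mk⇔
  (λ (inv , drop≤1) →
       (λ { zero → refl
          ; (suc zero) → refl
          ; (suc (suc i)) → trans (lookup² i) (cong (Fin.suc ∘ Fin.suc) (inv i)) })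
     , (λ { zero → z≤n
          ; (suc zero) → s≤s z≤n
          ; (suc (suc i)) → subst (_≤ 1) (sym (deficiency≡ i)) (drop≤1 i) }))
  (λ (inv , drop≤1) →
       (λ i → Finₚ.suc-injective (Finₚ.suc-injective (trans (sym (lookup² i)) (inv (suc (suc i))))))
     , (λ i → subst (_≤ 1) (deficiency≡ i) (drop≤1 (suc (suc i)))))
  where
  lookup² : ∀ i → lookup (swap∷ w) (lookup (swap∷ w) (suc (suc i))) ≡ suc (suc (lookup w (lookup w i)))
  lookup² i = trans (cong (lookup (swap∷ w)) (Vecₚ.lookup-map i (Fin.suc ∘ Fin.suc) w))
                    (Vecₚ.lookup-map (lookup w i) (Fin.suc ∘ Fin.suc) w)
  deficiency≡ : ∀ i → deficiency (swap∷ w) (suc (suc i)) ≡ deficiency w i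
  deficiency≡ i = cong (λ x → toℕ (suc (suc i)) ∸ toℕ x) (Vecₚ.lookup-map i (Fin.suc ∘ Fin.suc) w)

map-suc-surjective : (v : Vec (Fin (suc n)) k) → (∀ i → lookup v i ≢ zero) → ∃[ u ] Vec.map suc u ≡ v
map-suc-surjective []          _   = [] , refl
map-suc-surjective (zero  ∷ v) v≢0 = ⊥-elim (v≢0 zero refl)
map-suc-surjective (suc x ∷ v) v≢0 =
  let u , u↦v = map-suc-surjective v (v≢0 ∘ suc) in x ∷ u , cong (suc x ∷_) u↦v

map-suc²-surjective : (v : Vec (Fin (suc (suc n))) k) →
                      (∀ i → lookup v i ≢ zero) → (∀ i → lookup v i ≢ suc zero) →
                      ∃[ u ] Vec.map (Fin.suc ∘ Fin.suc) u ≡ v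
map-suc²-surjective []                _   _   = [] , refl
map-suc²-surjective (zero        ∷ v) v≢0 _   = ⊥-elim (v≢0 zero refl)
map-suc²-surjective (suc zero    ∷ v) _   v≢1 = ⊥-elim (v≢1 zero refl)
map-suc²-surjective (suc (suc x) ∷ v) v≢0 v≢1 =
  let u , u↦v = map-suc²-surjective v (v≢0 ∘ suc) (v≢1 ∘ suc) in x ∷ u , cong (suc (suc x) ∷_) u↦v

fix∷-surjective : (π : Word (suc n)) → IsInvolution π → lookup π zero ≡ zero → ∃[ w ] fix∷ w ≡ π
fix∷-surjective π@(x ∷ r) inv refl =
  let w , w↦r = map-suc-surjective r r≢0 in w , cong (zero ∷_) w↦r
  where
  r≢0 : ∀ i → lookup r i ≢ zero
  r≢0 i rᵢ≡0 = Finₚ.0≢1+n (trans (sym (cong (lookup π) rᵢ≡0)) (inv (suc i)))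

swap∷-surjective : (π : Word (suc (suc n))) → IsInvolution π → lookup π zero ≡ suc zero →
                   ∃[ w ] swap∷ w ≡ π
swap∷-surjective π@(x ∷ y ∷ r) inv refl =
  let w , w↦r = map-suc²-surjective r r≢0 r≢1
  in  w , cong₂ (λ y t → suc zero ∷ y ∷ t) (sym (inv zero)) w↦r
  where
  r≢0 : ∀ i → lookup r i ≢ zero
  r≢0 i rᵢ≡0 =
    Finₚ.0≢1+n (Finₚ.suc-injective (trans (sym (cong (lookup π) rᵢ≡0)) (inv (suc (suc i)))))
  r≢1 : ∀ i → lookup r i ≢ suc zero
  r≢1 i rᵢ≡1 =
    Finₚ.0≢1+n (trans (sym (trans (cong (lookup π) rᵢ≡1) (inv zero))) (inv (suc (suc i))))

adjacentInvolution-head≤1 : (π : Word (suc n)) → IsAdjacentInvolution π → toℕ (lookup π zero) ≤ 1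
adjacentInvolution-head≤1 π (inv , drop≤1) =
  subst (λ x → toℕ (lookup π zero) ∸ toℕ x ≤ 1) (inv zero) (drop≤1 (lookup π zero))

map-complete : {xs : List (Word m)} (c : Word m → Word k) →
               (∀ {w} → IsAdjacentInvolution (c w) → IsAdjacentInvolution w) →
               (∀ w → IsAdjacentInvolution w → w ∈ xs) →
               {π : Word k} → ∃[ w ] c w ≡ π → IsAdjacentInvolution π → π ∈ map c xs
map-complete c c-reflects xs-complete (w , refl) adj = ∈-map⁺ c (xs-complete w (c-reflects adj))

map-sound : {xs : List (Word m)} (c : Word m → Word k) →
            (∀ {w} → IsAdjacentInvolution w → IsAdjacentInvolution (c w)) →
            (∀ {w} → w ∈ xs → IsAdjacentInvolution w) →
            {π : Word k} → π ∈ map c xs → IsAdjacentInvolution π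
map-sound c c-preserves xs-sound π∈ =
  let w , w∈ , π≡cw = ∈-map⁻ c π∈
  in  subst IsAdjacentInvolution (sym π≡cw) (c-preserves (xs-sound w∈))

adjacentInvolution-split : (π : Word (suc (suc n))) → IsAdjacentInvolution π →
                           (∃[ w ] fix∷ w ≡ π) ⊎ (∃[ w ] swap∷ w ≡ π)
adjacentInvolution-split π adj with lookup π zero in π₀≡ | adjacentInvolution-head≤1 π adj
... | zero        | _      = inj₁ (fix∷-surjective π (proj₁ adj) π₀≡)
... | suc zero    | _      = inj₂ (swap∷-surjective π (proj₁ adj) π₀≡)
... | suc (suc _) | s≤s ()

adjacentInvolutions-complete : ∀ n (π : Word n) → IsAdjacentInvolution π → π ∈ adjacentInvolutions n
adjacentInvolutions-complete zero          []          _   = here refl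
adjacentInvolutions-complete (suc zero)    (zero ∷ []) _   = here refl
adjacentInvolutions-complete (suc (suc n)) π           adj =
  [ (λ w↦π → ∈-++⁺ˡ
        (map-complete fix∷ (from fix∷-adjacent⇔) (adjacentInvolutions-complete (suc n)) w↦π adj))
  , (λ w↦π → ∈-++⁺ʳ (map fix∷ (adjacentInvolutions (suc n)))
        (map-complete swap∷ (from swap∷-adjacent⇔) (adjacentInvolutions-complete n) w↦π adj))
  ]′ (adjacentInvolution-split π adj)

adjacentInvolutions-sound : ∀ n {π : Word n} → π ∈ adjacentInvolutions n → IsAdjacentInvolution π
adjacentInvolutions-sound zero          (here refl) = (λ ()) , (λ ())
adjacentInvolutions-sound (suc zero)    (here refl) = to fix∷-adjacent⇔ ((λ ()) , (λ ()))
adjacentInvolutions-sound (suc (suc n)) π∈ =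
  [ map-sound fix∷ (to fix∷-adjacent⇔) (adjacentInvolutions-sound (suc n))
  , map-sound swap∷ (to swap∷-adjacent⇔) (adjacentInvolutions-sound n)
  ]′ (∈-++⁻ (map fix∷ (adjacentInvolutions (suc n))) π∈)

shallow321Involution⇔∈adjacentInvolutions : (π : Word n) →
  (IsPerm π × IsInvolution π × Avoids321 π × Shallow π) ⇔ π ∈ adjacentInvolutions n
shallow321Involution⇔∈adjacentInvolutions {n} π = mk⇔
  (λ (_ , inv , avoids , shallow) →
     adjacentInvolutions-complete n π (inv , to (shallow⇔deficiency≤1 inv avoids) shallow))
  (λ π∈ → let adj@(inv , drop≤1) = adjacentInvolutions-sound n π∈
              avoids = adjacentInvolution⇒avoids321 π adj
          in involution⇒perm π inv , inv , avoids , from (shallow⇔deficiency≤1 inv avoids) drop≤1)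

theorem6p5 : (n : ℕ) → 1 ≤ n → numShallow321Inv n ≡ F (suc n)
theorem6p5 n _ = begin
  numShallow321Inv n             ≡⟨ length-filter-words _ (adjacentInvolutions-unique n)
                                      (shallow321Involution⇔∈adjacentInvolutions _) ⟩
  length (adjacentInvolutions n) ≡⟨ length-adjacentInvolutions n ⟩
  F (suc n)                      ∎
  where open ≡-Reasoning
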